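{- Let $C$ be a binary linear code of length $n$ which is isodual, let $X:=\{1,\ldots,n\}$, and let $G=\mathrm{Aut}(C)$. Let $\sigma\in S_n$ be such that $C^\perp=C^\sigma$. Let $t$ be a positive integer; $G$ acts on the set $\binom{X}{t}$ of $t$-subsets of $X$, and assume that this action has exactly two orbits, \[ \binom{X}{t}=GT_1\sqcup GT_2, \] with $(GT_1)^\sigma=GT_2$. Then: (1) $J_{C,T}+J_{C^\perp,T}$ is independent of the choice of $T\subseteq X$ with $|T|=t$. (2) Let $f\in \mathrm{Harm}_t$ be a harmonic function of degree $t$ which is invariant under $\mathrm{Aut}(C)$, i.e. $f^\tau=f$ for all $\tau\in\mathrm{Aut}(C)$. Then \[ w_{C,f}+w_{C^\perp,f}=0. \]
   Context: A binary linear code of length $n$ is a subspace $C\subseteq\mathbb{F}_2^n$; its dual is $C^\perp=\{y\in\mathbb{F}_2^n : \sum_i x_iy_i=0 \ \forall x\in C\}$. For $\sigma\in S_n$, $C^\sigma:=\{(c_{\sigma(1)},\ldots,c_{\sigma(n)}) : (c_1,\ldots,c_n)\in C\}$, and $\mathrm{Aut}(C)=\{\sigma\in S_n: C^\sigma=C\}$. $C$ is isodual if $C$ and $C^\perp$ are equivalent (i.e. $C^\perp=C^\sigma$ for some $\sigma\in S_n$). $S_n$ acts on subsets of $X$ by $\{i_1,\ldots,i_k\}^\tau=\{\tau(i_1),\ldots,\tau(i_k)\}$; for a set $\mathcal{S}$ of subsets, $\mathcal{S}^\tau=\{S^\tau:S\in\mathcal{S}\}$. Jacobi polynomial: for $T\subseteq[n]$,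 $J_{C,T}(w,z,x,y)=\sum_{c\in C}w^{m_0(c)}z^{m_1(c)}x^{n_0(c)}y^{n_1(c)}$, where $m_i(c)=|\{j\in T: c_j=i\}|$ and $n_i(c)=|\{j\in[n]\setminus T: c_j=i\}|$. Harmonic functions: let $\mathbb{R}X_k$ be the real vector space with basis the $k$-subsets of $X$; elements $f=\sum_{z}f(z)z$ are identified with functions on $k$-subsets. For $f\in\mathbb{R}X_k$ define $\widetilde f(u)=\sum_{z\subseteq u,|z|=k}f(z)$ for all $u\subseteq X$. The differentiation $\gamma$ is the linear map with $\gamma(z)=\sum_{y\subset z,|y|=k-1}y$ for each $k$-subset $z$, and $\mathrm{Harm}_k=\ker(\gamma|_{\mathbb{R}X_k})$. The action of $S_n$ on $\mathrm{Harm}_k$ is by linear extension of the action on $k$-subsets. For $f\in\mathrm{Harm}_k$, the harmonic weight enumerator is $w_{C,f}(x,y)=\sum_{c\in C}\widetilde f(\mathrm{supp}(c))x^{n-\mathrm{wt}(c)}y^{\mathrm{wt}(c)}$, where $\mathrm{supp}(c)=\{i:c_i\neq0\}$ and $\mathrm{wt}(c)=|\mathrm{supp}(c)|$. -}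

module Defs where

open import Level using (Level)
open import Data.Bool using (Bool; true; false; not; _∧_; _∨_; _xor_; if_then_else_)
open import Data.Nat using (ℕ; zero; suc; _≡ᵇ_)
open import Data.List using (List; []; _∷_; map; _++_; foldr)
open import Data.Bool.ListAction using (and)
open import Data.Vec using (Vec; []; _∷_; zipWith; tabulate; lookup; toList)
open import Data.Fin.Subset using (Subset; ∣_∣; ∁; _∩_)
open import Data.Fin.Permutation using (Permutation′; _⟨$⟩ʳ_; _⟨$⟩ˡ_; flip)
open import Data.Product using (Σ; _×_; ∃)
open import Data.Sum using (_⊎_)
open import Data.Unit using (⊤)
open import Relation.Binary.PropositionalEquality using (_≡_)
open import Algebra.Bundles using (CommutativeRing)

-- Words of F_2^n are identified with subsets of X = Fin n (their supports):
-- a word c is a Vec Bool n, c_i = 1 iff lookup c i = true.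
Word : ℕ → Set
Word = Subset

allWords : (n : ℕ) → List (Word n)
allWords zero = [] ∷ []
allWords (suc n) = map (true ∷_) (allWords n) ++ map (false ∷_) (allWords n)

WordSet : ℕ → Set
WordSet n = Word n → Bool

_⊕_ : ∀ {n} → Word n → Word n → Word n
x ⊕ y = zipWith _xor_ x y

zeroWord : ∀ n → Word n
zeroWord n = tabulate (λ _ → false)

IsLinearCode : ∀ {n} → WordSet n → Set
IsLinearCode {n} C =
  (C (zeroWord n) ≡ true) ×
  (∀ x y → C x ≡ true → C y ≡ true → C (x ⊕ y) ≡ true)

dot : ∀ {n} → Word n → Word n → Bool
dot x y = foldr _xor_ false (toList (zipWith _∧_ x y))

dual : ∀ {n} → WordSet n → WordSet n
dual {n} C y = and (map (λ x → not (C x) ∨ not (dot x y)) (allWords n))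

CodeEq : ∀ {n} → WordSet n → WordSet n → Set
CodeEq C D = ∀ d → C d ≡ D d

-- C^σ = { (c_{σ(1)},…,c_{σ(n)}) : c ∈ C }; d ∈ C^σ iff d∘σ⁻¹ ∈ C
_^ᶜ_ : ∀ {n} → WordSet n → Permutation′ n → WordSet n
(C ^ᶜ σ) d = C (tabulate (λ i → lookup d (σ ⟨$⟩ˡ i)))

Aut : ∀ {n} → WordSet n → Permutation′ n → Set
Aut C τ = CodeEq (C ^ᶜ τ) C

-- action on subsets: S^τ = { τ(i) : i ∈ S }, i.e. j ∈ S^τ iff τ⁻¹(j) ∈ S
_^ˢ_ : ∀ {n} → Subset n → Permutation′ n → Subset n
(S ^ˢ τ) = tabulate (λ j → lookup S (τ ⟨$⟩ˡ j))

InOrbit : ∀ {n} → WordSet n → Subset n → Subset n → Set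
InOrbit C T S = ∃ λ τ → Aut C τ × (S ≡ T ^ˢ τ)

count : ∀ {A : Set} → (A → Bool) → List A → ℕ
count p [] = 0
count p (x ∷ xs) = if p x then suc (count p xs) else count p xs

-- Jacobi polynomial J_{C,T}(w,z,x,y), represented by its coefficient
-- function: jacobi C T a b c d = coefficient of w^a z^b x^c y^d
--   = #{ c ∈ C : m₀(c)=a, m₁(c)=b, n₀(c)=c, n₁(c)=d }.
jacobi : ∀ {n} → WordSet n → Subset n → ℕ → ℕ → ℕ → ℕ → ℕ
jacobi {n} C T a b c d = count ok (allWords n)
  where
  ok : Word n → Bool
  ok w = C w ∧ (∣ T ∩ ∁ w ∣ ≡ᵇ a) ∧ (∣ T ∩ w ∣ ≡ᵇ b)
             ∧ (∣ ∁ T ∩ ∁ w ∣ ≡ᵇ c) ∧ (∣ ∁ T ∩ w ∣ ≡ᵇ d)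

_⊆ᵇ_ : ∀ {n} → Subset n → Subset n → Bool
z ⊆ᵇ u = and (toList (zipWith (λ a b → not a ∨ b) z u))

-- Harmonic functions with values in a commutative ring R.
-- An element f of R X_k is given as a function on all subsets of Fin n;
-- only its values on k-subsets are ever used.
module Harmonic {c ℓ : Level} (R : CommutativeRing c ℓ) where
  open CommutativeRing R

  sumR : ∀ {A : Set} → (A → Carrier) → List A → Carrier
  sumR g [] = 0#
  sumR g (x ∷ xs) = g x + sumR g xs

  sumWhere : ∀ {A : Set} → (A → Bool) → (A → Carrier) → List A → Carrier
  sumWhere p g = sumR (λ x → if p x then g x else 0#)

  tilde : ∀ {n} → ℕ → (Subset n → Carrier) → Subset n → Carrier
  tilde {n} k f u = sumWhere (λ z → (∣ z ∣ ≡ᵇ k) ∧ (z ⊆ᵇ u)) f (allWords n)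

  -- f ∈ Harm_k: γ f = 0, where (γ f)(y) = Σ_{|z| = k, y ⊂ z} f(z)
  -- for each (k-1)-subset y.  (Harm_0 = R X_0.)
  IsHarmonic : ∀ {n} → ℕ → (Subset n → Carrier) → Set ℓ
  IsHarmonic zero f = Level.Lift _ ⊤
  IsHarmonic {n} (suc k) f =
    ∀ y → ∣ y ∣ ≡ k →
      sumWhere (λ z → (∣ z ∣ ≡ᵇ suc k) ∧ (y ⊆ᵇ z)) f (allWords n) ≈ 0#

  -- f^τ = f for all τ ∈ Aut(C), with (f^τ)(z) = f(z^{τ⁻¹})
  IsAutInvariant : ∀ {n} → WordSet n → ℕ → (Subset n → Carrier) → Set ℓ
  IsAutInvariant C k f =
    ∀ τ → Aut C τ → ∀ z → ∣ z ∣ ≡ k → f (z ^ˢ flip τ) ≈ f z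

  -- harmonic weight enumerator w_{C,f}(x,y), represented by its
  -- coefficient function: harmWE C k f i = coefficient of x^{n-i} y^i
  --   = Σ_{c ∈ C, wt(c) = i} f~(supp c).
  harmWE : ∀ {n} → WordSet n → ℕ → (Subset n → Carrier) → ℕ → Carrier
  harmWE {n} C k f i =
    sumWhere (λ w → C w ∧ (∣ w ∣ ≡ᵇ i)) (tilde k f) (allWords n)

  -- characteristic zero / no additive torsion (as for ℝ)
  -- m · x = x + … + x (m times)
  natMul : ℕ → Carrier → Carrier
  natMul zero x = 0#
  natMul (suc m) x = x + natMul m x

  NoAdditiveTorsion : Set (c Level.⊔ ℓ)
  NoAdditiveTorsion = ∀ (m : ℕ) (x : Carrier) → natMul m x ≈ 0# → (m ≡ 0) ⊎ (x ≈ 0#)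

{-# OPTIONS --safe #-}

-- The two Aut(C)-orbits of t-sets are interchanged by σ: of S and S^σ, one lies in G T₁ and the
-- other in G T₂. Since C^⊥ = C^σ, the Jacobi polynomial of C^⊥ at S is that of C at S^σ, and
-- Jacobi polynomials of C are constant on orbits; hence J_{C,S} + J_{C^⊥,S} = J_{C,T₁} + J_{C,T₂}.
-- In the same way an Aut(C)-invariant f satisfies f S + f S^σ = f T₁ + f T₂. Summing over all
-- t-sets gives M (f T₁ + f T₂) = 2 Σ f with M the number of t-sets, and t Σ f = Σ_y (γ f)(y) = 0
-- because every t-set has t facets. Cancelling t and M (no additive torsion), f + f ∘ σ vanishes
-- on t-sets. Finally w_{C^σ,f} = w_{C,f ∘ σ⁻¹}, so w_{C,f} + w_{C^⊥,f} is the enumerator of a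
-- function vanishing on t-sets, which is 0.

module Submission where

open import Defs
open import Level using (Level)
open import Function using (_∘_)
open import Function.Bundles using (Equivalence; mk⇔)
open import Data.Bool using (Bool; true; false; not; _∧_; if_then_else_; T)
open import Data.Bool.Properties using (∧-zeroʳ; T-∧)
open import Data.Nat as ℕ using (ℕ; zero; suc; _≤_; s≤s; z≤n; _≡ᵇ_)
open import Data.Nat.Properties as ℕₚ using (≡ᵇ⇒≡; ≡⇒≡ᵇ; n≤1+n; m+n∸n≡m)
open import Data.Nat.Combinatorics using (nCk+nC[k+1]≡[n+1]C[k+1]; nCk≡nC[n∸k]; nC1≡n) renaming (_C_ to _choose_)
open import Data.Nat.ListAction using (sum)
open import Data.Nat.ListAction.Properties using (sum-↭)
open import Data.Fin using (Fin)
open import Data.Fin.Subset using (Subset; ∣_∣; ∁; _∩_)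
open import Data.Fin.Permutation using (Permutation′; _⟨$⟩ʳ_; _⟨$⟩ˡ_; flip; _∘ₚ_; inverseˡ; inverseʳ)
open import Data.Vec using ([]; _∷_; lookup)
open import Data.Vec.Properties using (lookup∘tabulate; tabulate∘lookup; tabulate-cong; lookup-zipWith; lookup-map)
open import Data.List as List using (List; []; _∷_; map; _++_; allFin)
open import Data.List.Properties using (map-tabulate)
open import Data.List.Membership.Propositional using (_∈_)
open import Data.List.Membership.Propositional.Properties using (∈-map⁺; ∈-map⁻; ∈-++⁺ˡ; ∈-++⁺ʳ; ∈-allFin)
open import Data.List.Membership.Propositional.Properties.WithK using (unique∧set⇒bag)
open import Data.List.Relation.Unary.Any using (here; there)
import Data.List.Relation.Unary.All as All
import Data.List.Relation.Unary.AllPairs as AllPairs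
open import Data.List.Relation.Unary.Unique.Propositional using (Unique)
import Data.List.Relation.Unary.Unique.Propositional.Properties as Unique
open import Data.List.Relation.Binary.Permutation.Propositional using (_↭_; ↭⇒↭ₛ′)
open import Data.List.Relation.Binary.Permutation.Propositional.Properties using (map⁺)
open import Data.List.Relation.Binary.BagAndSetEquality using (∼bag⇒↭)
open import Data.Product using (_×_; ∃; _,_; proj₁)
open import Data.Sum using (_⊎_; inj₁; inj₂)
open import Data.Empty using (⊥; ⊥-elim)
open import Data.Unit using (tt)
open import Relation.Nullary using (¬_)
open import Relation.Binary.PropositionalEquality using (_≡_; refl; sym; trans; cong; cong₂; subst; module ≡-Reasoning)
open import Algebra.Bundles using (CommutativeRing)

count-cong : ∀ {A : Set} {p q : A → Bool} → (∀ x → p x ≡ q x) → ∀ xs → count p xs ≡ count q xs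
count-cong e [] = refl
count-cong {q = q} e (x ∷ xs) rewrite e x with q x
... | true  = cong suc (count-cong e xs)
... | false = count-cong e xs

count-map : ∀ {A B : Set} (p : B → Bool) (h : A → B) xs → count p (map h xs) ≡ count (p ∘ h) xs
count-map p h [] = refl
count-map p h (x ∷ xs) with p (h x)
... | true  = cong suc (count-map p h xs)
... | false = count-map p h xs

count-++ : ∀ {A : Set} (p : A → Bool) xs ys → count p (xs ++ ys) ≡ count p xs ℕ.+ count p ys
count-++ p [] ys = refl
count-++ p (x ∷ xs) ys with p x
... | true  = cong suc (count-++ p xs ys)
... | false = count-++ p xs ys

count-false : ∀ {A : Set} (xs : List A) → count (λ _ → false) xs ≡ 0
count-false [] = refl
count-false (x ∷ xs) = count-false xs

count≡sum-map : ∀ {A : Set} (p : A → Bool) xs → count p xs ≡ sum (map (λ x → if p x then 1 else 0) xs)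
count≡sum-map p [] = refl
count≡sum-map p (x ∷ xs) with p x
... | true  = cong suc (count≡sum-map p xs)
... | false = count≡sum-map p xs

count-↭ : ∀ {A : Set} (p : A → Bool) {xs ys} → xs ↭ ys → count p xs ≡ count p ys
count-↭ p {xs} {ys} xs↭ys = begin
  count p xs                            ≡⟨ count≡sum-map p xs ⟩
  sum (map (λ x → if p x then 1 else 0) xs) ≡⟨ sum-↭ (map⁺ _ xs↭ys) ⟩
  sum (map (λ x → if p x then 1 else 0) ys) ≡⟨ count≡sum-map p ys ⟨
  count p ys                            ∎
  where open ≡-Reasoning

∈⇒count≢0 : ∀ {A : Set} (p : A → Bool) {x xs} → x ∈ xs → T (p x) → ¬ count p xs ≡ 0
∈⇒count≢0 p {xs = y ∷ ys} (here refl) px with p y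
... | true = λ ()
∈⇒count≢0 p {xs = y ∷ ys} (there x∈ys) px with p y
... | true  = λ ()
... | false = ∈⇒count≢0 p x∈ys px

map-inverse-↭ : ∀ {A : Set} {xs : List A} → Unique xs → (∀ x → x ∈ xs) →
  (h g : A → A) → (∀ x → h (g x) ≡ x) → (∀ x → g (h x) ≡ x) → map h xs ↭ xs
map-inverse-↭ {xs = xs} unique complete h g hg gh =
  ∼bag⇒↭ (unique∧set⇒bag (Unique.map⁺ h-injective unique) unique
    (λ {x} → mk⇔ (λ _ → complete x) (λ _ → subst (_∈ map h xs) (hg x) (∈-map⁺ h (complete (g x))))))
  where
  h-injective : ∀ {x y} → h x ≡ h y → x ≡ y
  h-injective {x} {y} e = trans (sym (gh x)) (trans (cong g e) (gh y))

-- Permuting coordinates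

lookup-^ˢ : ∀ {n} (w : Subset n) (ρ : Permutation′ n) i → lookup (w ^ˢ ρ) i ≡ lookup w (ρ ⟨$⟩ˡ i)
lookup-^ˢ w ρ = lookup∘tabulate _

≗-lookup⇒≡ : ∀ {n} {u v : Subset n} → (∀ i → lookup u i ≡ lookup v i) → u ≡ v
≗-lookup⇒≡ {u = u} {v} e = trans (sym (tabulate∘lookup u)) (trans (tabulate-cong e) (tabulate∘lookup v))

^ˢ-inverseˡ : ∀ {n} (ρ : Permutation′ n) w → (w ^ˢ ρ) ^ˢ flip ρ ≡ w
^ˢ-inverseˡ ρ w = ≗-lookup⇒≡ λ i →
  trans (lookup-^ˢ (w ^ˢ ρ) (flip ρ) i) (trans (lookup-^ˢ w ρ _) (cong (lookup w) (inverseˡ ρ)))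

^ˢ-inverseʳ : ∀ {n} (ρ : Permutation′ n) w → (w ^ˢ flip ρ) ^ˢ ρ ≡ w
^ˢ-inverseʳ ρ w = ≗-lookup⇒≡ λ i →
  trans (lookup-^ˢ (w ^ˢ flip ρ) ρ i) (trans (lookup-^ˢ w (flip ρ) _) (cong (lookup w) (inverseʳ ρ)))

^ˢ-∘ₚ : ∀ {n} (τ ρ : Permutation′ n) w → (w ^ˢ τ) ^ˢ ρ ≡ w ^ˢ (τ ∘ₚ ρ)
^ˢ-∘ₚ τ ρ w = ≗-lookup⇒≡ λ i →
  trans (lookup-^ˢ (w ^ˢ τ) ρ i) (trans (lookup-^ˢ w τ _) (sym (lookup-^ˢ w (τ ∘ₚ ρ) i)))

^ˢ-injective : ∀ {n} (ρ : Permutation′ n) {u v} → u ^ˢ ρ ≡ v ^ˢ ρ → u ≡ v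
^ˢ-injective ρ {u} {v} e = trans (sym (^ˢ-inverseˡ ρ u)) (trans (cong (_^ˢ flip ρ) e) (^ˢ-inverseˡ ρ v))

^ˢ-∩ : ∀ {n} (ρ : Permutation′ n) A B → (A ∩ B) ^ˢ ρ ≡ (A ^ˢ ρ) ∩ (B ^ˢ ρ)
^ˢ-∩ ρ A B = ≗-lookup⇒≡ λ i → begin
  lookup ((A ∩ B) ^ˢ ρ) i                        ≡⟨ lookup-^ˢ (A ∩ B) ρ i ⟩
  lookup (A ∩ B) (ρ ⟨$⟩ˡ i)                       ≡⟨ lookup-zipWith _∧_ _ A B ⟩
  lookup A (ρ ⟨$⟩ˡ i) ∧ lookup B (ρ ⟨$⟩ˡ i)       ≡⟨ cong₂ _∧_ (lookup-^ˢ A ρ i) (lookup-^ˢ B ρ i) ⟨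
  lookup (A ^ˢ ρ) i ∧ lookup (B ^ˢ ρ) i           ≡⟨ lookup-zipWith _∧_ i (A ^ˢ ρ) (B ^ˢ ρ) ⟨
  lookup ((A ^ˢ ρ) ∩ (B ^ˢ ρ)) i                  ∎
  where open ≡-Reasoning

^ˢ-∁ : ∀ {n} (ρ : Permutation′ n) A → ∁ A ^ˢ ρ ≡ ∁ (A ^ˢ ρ)
^ˢ-∁ ρ A = ≗-lookup⇒≡ λ i → begin
  lookup (∁ A ^ˢ ρ) i         ≡⟨ lookup-^ˢ (∁ A) ρ i ⟩
  lookup (∁ A) (ρ ⟨$⟩ˡ i)     ≡⟨ lookup-map _ not A ⟩
  not (lookup A (ρ ⟨$⟩ˡ i))   ≡⟨ cong not (lookup-^ˢ A ρ i) ⟨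
  not (lookup (A ^ˢ ρ) i)     ≡⟨ lookup-map i not (A ^ˢ ρ) ⟨
  lookup (∁ (A ^ˢ ρ)) i       ∎
  where open ≡-Reasoning

allWords-complete : ∀ n (w : Word n) → w ∈ allWords n
allWords-complete zero [] = here refl
allWords-complete (suc n) (true ∷ w) = ∈-++⁺ˡ (∈-map⁺ (true ∷_) (allWords-complete n w))
allWords-complete (suc n) (false ∷ w) =
  ∈-++⁺ʳ (map (true ∷_) (allWords n)) (∈-map⁺ (false ∷_) (allWords-complete n w))

allWords-unique : ∀ n → Unique (allWords n)
allWords-unique zero = All.[] AllPairs.∷ AllPairs.[]
allWords-unique (suc n) =
  Unique.++⁺ (Unique.map⁺ ∷-injectiveʳ (allWords-unique n)) (Unique.map⁺ ∷-injectiveʳ (allWords-unique n)) disjoint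
  where
  ∷-injectiveʳ : ∀ {b} {u v : Word n} → b ∷ u ≡ b ∷ v → u ≡ v
  ∷-injectiveʳ refl = refl
  disjoint : ∀ {w} → w ∈ map (true ∷_) (allWords n) × w ∈ map (false ∷_) (allWords n) → ⊥
  disjoint (t , f) with ∈-map⁻ (true ∷_) t | ∈-map⁻ (false ∷_) f
  ... | _ , _ , refl | _ , _ , ()

map-^ˢ-allWords : ∀ {n} (ρ : Permutation′ n) → map (_^ˢ ρ) (allWords n) ↭ allWords n
map-^ˢ-allWords {n} ρ =
  map-inverse-↭ (allWords-unique n) (allWords-complete n) (_^ˢ ρ) (_^ˢ flip ρ) (^ˢ-inverseʳ ρ) (^ˢ-inverseˡ ρ)

count-^ˢ : ∀ {n} (ρ : Permutation′ n) (p : Word n → Bool) →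
  count (λ w → p (w ^ˢ ρ)) (allWords n) ≡ count p (allWords n)
count-^ˢ {n} ρ p = trans (sym (count-map p (_^ˢ ρ) (allWords n))) (count-↭ p (map-^ˢ-allWords ρ))

count-lookup-∷ : ∀ {n} b (w : Subset n) → count (lookup (b ∷ w)) (List.tabulate Fin.suc) ≡ count (lookup w) (allFin n)
count-lookup-∷ {n} b w = trans (cong (count (lookup (b ∷ w))) (sym (map-tabulate (λ i → i) Fin.suc)))
  (count-map (lookup (b ∷ w)) Fin.suc (allFin n))

∣∣≡count-lookup : ∀ {n} (w : Subset n) → ∣ w ∣ ≡ count (lookup w) (allFin n)
∣∣≡count-lookup [] = refl
∣∣≡count-lookup (true ∷ w)  = cong suc (trans (∣∣≡count-lookup w) (sym (count-lookup-∷ true w)))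
∣∣≡count-lookup (false ∷ w) = trans (∣∣≡count-lookup w) (sym (count-lookup-∷ false w))

∣^ˢ∣ : ∀ {n} (ρ : Permutation′ n) w → ∣ w ^ˢ ρ ∣ ≡ ∣ w ∣
∣^ˢ∣ {n} ρ w = begin
  ∣ w ^ˢ ρ ∣                                      ≡⟨ ∣∣≡count-lookup (w ^ˢ ρ) ⟩
  count (lookup (w ^ˢ ρ)) (allFin n)              ≡⟨ count-cong (lookup-^ˢ w ρ) (allFin n) ⟩
  count (lookup w ∘ (ρ ⟨$⟩ˡ_)) (allFin n)         ≡⟨ count-map (lookup w) (ρ ⟨$⟩ˡ_) (allFin n) ⟨
  count (lookup w) (map (ρ ⟨$⟩ˡ_) (allFin n))     ≡⟨ count-↭ (lookup w) ρˡ-permutes ⟩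
  count (lookup w) (allFin n)                     ≡⟨ ∣∣≡count-lookup w ⟨
  ∣ w ∣                                           ∎
  where
  open ≡-Reasoning
  ρˡ-permutes : map (ρ ⟨$⟩ˡ_) (allFin n) ↭ allFin n
  ρˡ-permutes = map-inverse-↭ (Unique.allFin⁺ n) ∈-allFin (ρ ⟨$⟩ˡ_) (ρ ⟨$⟩ʳ_) (λ _ → inverseˡ ρ) (λ _ → inverseʳ ρ)

⊆ᵇ≡∩∁-empty : ∀ {n} (z u : Subset n) → (z ⊆ᵇ u) ≡ (∣ z ∩ ∁ u ∣ ≡ᵇ 0)
⊆ᵇ≡∩∁-empty [] [] = refl
⊆ᵇ≡∩∁-empty (true ∷ z)  (true ∷ u)  = ⊆ᵇ≡∩∁-empty z u
⊆ᵇ≡∩∁-empty (true ∷ z)  (false ∷ u) = refl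
⊆ᵇ≡∩∁-empty (false ∷ z) (true ∷ u)  = ⊆ᵇ≡∩∁-empty z u
⊆ᵇ≡∩∁-empty (false ∷ z) (false ∷ u) = ⊆ᵇ≡∩∁-empty z u

∣∩∣-^ˢ : ∀ {n} (ρ : Permutation′ n) A B → ∣ A ^ˢ ρ ∩ B ^ˢ ρ ∣ ≡ ∣ A ∩ B ∣
∣∩∣-^ˢ ρ A B = trans (cong ∣_∣ (sym (^ˢ-∩ ρ A B))) (∣^ˢ∣ ρ (A ∩ B))

^ˢ-⊆ᵇ : ∀ {n} (ρ : Permutation′ n) z u → ((z ^ˢ ρ) ⊆ᵇ (u ^ˢ ρ)) ≡ (z ⊆ᵇ u)
^ˢ-⊆ᵇ ρ z u rewrite ⊆ᵇ≡∩∁-empty (z ^ˢ ρ) (u ^ˢ ρ) | ⊆ᵇ≡∩∁-empty z u | sym (^ˢ-∁ ρ u) | ∣∩∣-^ˢ ρ z (∁ u) = refl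

count-subsets : ∀ n (z : Subset n) m → count (λ y → (∣ y ∣ ≡ᵇ m) ∧ (y ⊆ᵇ z)) (allWords n) ≡ ∣ z ∣ choose m
count-subsets zero [] zero    = refl
count-subsets zero [] (suc m) = refl
count-subsets (suc n) (b ∷ z) m = begin
  count P (map (true ∷_) ws ++ map (false ∷_) ws)
    ≡⟨ count-++ P (map (true ∷_) ws) (map (false ∷_) ws) ⟩
  count P (map (true ∷_) ws) ℕ.+ count P (map (false ∷_) ws)
    ≡⟨ cong₂ ℕ._+_ (count-map P (true ∷_) ws) (trans (count-map P (false ∷_) ws) (count-subsets n z m)) ⟩
  count (P ∘ (true ∷_)) ws ℕ.+ ∣ z ∣ choose m
    ≡⟨ pascal b m ⟩
  ∣ b ∷ z ∣ choose m ∎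
  where
  open ≡-Reasoning
  ws : List (Word n)
  ws = allWords n
  P : Subset (suc n) → Bool
  P y = (∣ y ∣ ≡ᵇ m) ∧ (y ⊆ᵇ (b ∷ z))
  pascal : ∀ b m → count (λ y → (suc ∣ y ∣ ≡ᵇ m) ∧ (b ∧ (y ⊆ᵇ z))) ws ℕ.+ ∣ z ∣ choose m ≡ ∣ b ∷ z ∣ choose m
  pascal b zero = cong (ℕ._+ 1) (count-false ws)
  pascal true (suc m) = trans (cong (ℕ._+ ∣ z ∣ choose suc m) (count-subsets n z m)) (nCk+nC[k+1]≡[n+1]C[k+1] ∣ z ∣ m)
  pascal false (suc m) = cong (ℕ._+ ∣ z ∣ choose suc m) (trans (count-cong (λ y → ∧-zeroʳ (∣ y ∣ ≡ᵇ m)) ws) (count-false ws))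

[1+k]Ck≡1+k : ∀ k → suc k choose k ≡ suc k
[1+k]Ck≡1+k k = trans (nCk≡nC[n∸k] (n≤1+n k)) (trans (cong (suc k choose_) (m+n∸n≡m 1 k)) (nC1≡n (suc k)))

-- Orbits and Jacobi polynomials

jacobi-cong : ∀ {n} {D E : WordSet n} → CodeEq D E → ∀ T a b c d → jacobi D T a b c d ≡ jacobi E T a b c d
jacobi-cong {n} D≡E T a b c d = count-cong (λ w → cong (_∧ _) (D≡E w)) (allWords n)

jacobi-^ᶜ : ∀ {n} (C : WordSet n) (ρ : Permutation′ n) T a b c d → jacobi (C ^ᶜ ρ) T a b c d ≡ jacobi C (T ^ˢ ρ) a b c d
jacobi-^ᶜ {n} C ρ T a b c d = trans (count-cong agree (allWords n)) (count-^ˢ ρ _)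
  where
  agree : ∀ w →
      C (w ^ˢ ρ) ∧ (∣ T ∩ ∁ w ∣ ≡ᵇ a) ∧ (∣ T ∩ w ∣ ≡ᵇ b) ∧ (∣ ∁ T ∩ ∁ w ∣ ≡ᵇ c) ∧ (∣ ∁ T ∩ w ∣ ≡ᵇ d)
    ≡ C (w ^ˢ ρ) ∧ (∣ T ^ˢ ρ ∩ ∁ (w ^ˢ ρ) ∣ ≡ᵇ a) ∧ (∣ T ^ˢ ρ ∩ w ^ˢ ρ ∣ ≡ᵇ b)
                 ∧ (∣ ∁ (T ^ˢ ρ) ∩ ∁ (w ^ˢ ρ) ∣ ≡ᵇ c) ∧ (∣ ∁ (T ^ˢ ρ) ∩ w ^ˢ ρ ∣ ≡ᵇ d)
  agree w rewrite sym (^ˢ-∁ ρ w) | sym (^ˢ-∁ ρ T)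
                | ∣∩∣-^ˢ ρ T (∁ w) | ∣∩∣-^ˢ ρ T w | ∣∩∣-^ˢ ρ (∁ T) (∁ w) | ∣∩∣-^ˢ ρ (∁ T) w = refl

aut-∘ₚ : ∀ {n} {C : WordSet n} {τ ρ} → Aut C τ → Aut C ρ → Aut C (τ ∘ₚ ρ)
aut-∘ₚ {C = C} {τ} {ρ} autτ autρ d = trans (cong C (sym (^ˢ-∘ₚ τ ρ d))) (trans (autρ (d ^ˢ τ)) (autτ d))

aut-flip : ∀ {n} {C : WordSet n} {τ} → Aut C τ → Aut C (flip τ)
aut-flip {C = C} {τ} autτ d = trans (sym (autτ (d ^ˢ flip τ))) (cong C (^ˢ-inverseʳ τ d))

inOrbit-join : ∀ {n} {C : WordSet n} {T U S} → InOrbit C T S → InOrbit C U S → InOrbit C T U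
inOrbit-join {C = C} {T} {U} (α , autα , S≡Tα) (β , autβ , S≡Uβ) =
  α ∘ₚ flip β , aut-∘ₚ {C = C} {α} {flip β} autα (aut-flip {C = C} {β} autβ) ,
  trans (sym (^ˢ-inverseˡ β U)) (trans (cong (_^ˢ flip β) (trans (sym S≡Uβ) S≡Tα)) (^ˢ-∘ₚ α (flip β) T))

jacobi-inOrbit : ∀ {n} {C : WordSet n} {T S} → InOrbit C T S → ∀ a b c d → jacobi C S a b c d ≡ jacobi C T a b c d
jacobi-inOrbit {C = C} {T} (α , autα , refl) a b c d = trans (sym (jacobi-^ᶜ C α T a b c d)) (jacobi-cong autα T a b c d)

record SwapsOrbits {n} (C : WordSet n) (σ : Permutation′ n) (t : ℕ) (T₁ T₂ : Subset n) : Set where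
  field
    swapped : ∀ S → ∣ S ∣ ≡ t → (InOrbit C T₁ S × InOrbit C T₂ (S ^ˢ σ)) ⊎ (InOrbit C T₂ S × InOrbit C T₁ (S ^ˢ σ))

open SwapsOrbits

swapsOrbits : ∀ {n} {C : WordSet n} {σ t T₁ T₂} →
  (∀ S → ∣ S ∣ ≡ t → InOrbit C T₁ S ⊎ InOrbit C T₂ S) → ¬ InOrbit C T₁ T₂ →
  (∀ S → InOrbit C T₁ S → InOrbit C T₂ (S ^ˢ σ)) →
  (∀ S → InOrbit C T₂ S → ∃ λ S′ → InOrbit C T₁ S′ × (S ≡ S′ ^ˢ σ)) →
  SwapsOrbits C σ t T₁ T₂
swapsOrbits {C = C} {σ} {t} {T₁} {T₂} cover distinct σ[GT₁]⊆GT₂ GT₂⊆σ[GT₁] = record { swapped = swap }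
  where
  swap : ∀ S → ∣ S ∣ ≡ t → (InOrbit C T₁ S × InOrbit C T₂ (S ^ˢ σ)) ⊎ (InOrbit C T₂ S × InOrbit C T₁ (S ^ˢ σ))
  swap S ∣S∣ with cover S ∣S∣
  ... | inj₁ S∈GT₁ = inj₁ (S∈GT₁ , σ[GT₁]⊆GT₂ S S∈GT₁)
  ... | inj₂ S∈GT₂ with cover (S ^ˢ σ) (trans (∣^ˢ∣ σ S) ∣S∣)
  ...   | inj₁ Sσ∈GT₁ = inj₂ (S∈GT₂ , Sσ∈GT₁)
  ...   | inj₂ Sσ∈GT₂ with GT₂⊆σ[GT₁] (S ^ˢ σ) Sσ∈GT₂
  ...     | S′ , S′∈GT₁ , Sσ≡S′σ =
    ⊥-elim (distinct (inOrbit-join {T = T₁} {U = T₂} (subst (InOrbit C T₁) (sym (^ˢ-injective σ Sσ≡S′σ)) S′∈GT₁) S∈GT₂))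

jacobi-+-dual : ∀ {n} {C : WordSet n} {σ t T₁ T₂} → CodeEq (dual C) (C ^ᶜ σ) → SwapsOrbits C σ t T₁ T₂ →
  ∀ S → ∣ S ∣ ≡ t → ∀ a b c d → jacobi C S a b c d ℕ.+ jacobi (dual C) S a b c d ≡ jacobi C T₁ a b c d ℕ.+ jacobi C T₂ a b c d
jacobi-+-dual {C = C} {σ} {T₁ = T₁} {T₂} dual≡Cσ swaps S ∣S∣ a b c d = begin
  jacobi C S a b c d ℕ.+ jacobi (dual C) S a b c d
    ≡⟨ cong (jacobi C S a b c d ℕ.+_) (trans (jacobi-cong dual≡Cσ S a b c d) (jacobi-^ᶜ C σ S a b c d)) ⟩
  jacobi C S a b c d ℕ.+ jacobi C (S ^ˢ σ) a b c d
    ≡⟨ orbit-values (swapped swaps S ∣S∣) ⟩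
  jacobi C T₁ a b c d ℕ.+ jacobi C T₂ a b c d ∎
  where
  open ≡-Reasoning
  orbit-values : (InOrbit C T₁ S × InOrbit C T₂ (S ^ˢ σ)) ⊎ (InOrbit C T₂ S × InOrbit C T₁ (S ^ˢ σ)) →
    jacobi C S a b c d ℕ.+ jacobi C (S ^ˢ σ) a b c d ≡ jacobi C T₁ a b c d ℕ.+ jacobi C T₂ a b c d
  orbit-values (inj₁ (S∈GT₁ , Sσ∈GT₂)) = cong₂ ℕ._+_ (jacobi-inOrbit {T = T₁} S∈GT₁ a b c d) (jacobi-inOrbit {T = T₂} Sσ∈GT₂ a b c d)
  orbit-values (inj₂ (S∈GT₂ , Sσ∈GT₁)) =
    trans (cong₂ ℕ._+_ (jacobi-inOrbit {T = T₂} S∈GT₂ a b c d) (jacobi-inOrbit {T = T₁} Sσ∈GT₁ a b c d))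
          (ℕₚ.+-comm (jacobi C T₂ a b c d) (jacobi C T₁ a b c d))

module _ {r ℓ} (R : CommutativeRing r ℓ) where
  open CommutativeRing R hiding (zero) renaming (refl to ≈-refl; sym to ≈-sym; trans to ≈-trans)
  open Harmonic R
  open import Relation.Binary.Reasoning.Setoid setoid
  open import Algebra.Properties.CommutativeSemigroup +-commutativeSemigroup using (interchange)
  open import Data.List.Relation.Binary.Permutation.Setoid.Properties setoid using (foldr-commMonoid)

  sumR-cong : ∀ {A : Set} {g h : A → Carrier} → (∀ x → g x ≈ h x) → ∀ xs → sumR g xs ≈ sumR h xs
  sumR-cong g≈h [] = ≈-refl
  sumR-cong g≈h (x ∷ xs) = +-cong (g≈h x) (sumR-cong g≈h xs)

  sumR-+ : ∀ {A : Set} (g h : A → Carrier) xs → sumR (λ x → g x + h x) xs ≈ sumR g xs + sumR h xs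
  sumR-+ g h [] = ≈-sym (+-identityˡ 0#)
  sumR-+ g h (x ∷ xs) = ≈-trans (+-congˡ (sumR-+ g h xs)) (interchange _ _ _ _)

  sumR-0 : ∀ {A : Set} {g : A → Carrier} → (∀ x → g x ≈ 0#) → ∀ xs → sumR g xs ≈ 0#
  sumR-0 g≈0 [] = ≈-refl
  sumR-0 g≈0 (x ∷ xs) = ≈-trans (+-cong (g≈0 x) (sumR-0 g≈0 xs)) (+-identityˡ 0#)

  sumR-comm : ∀ {A B : Set} (g : A → B → Carrier) xs ys →
    sumR (λ x → sumR (g x) ys) xs ≈ sumR (λ y → sumR (λ x → g x y) xs) ys
  sumR-comm g [] ys = ≈-sym (sumR-0 (λ _ → ≈-refl) ys)
  sumR-comm g (x ∷ xs) ys = ≈-trans (+-congˡ (sumR-comm g xs ys)) (≈-sym (sumR-+ (g x) _ ys))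

  sumR≡foldr : ∀ {A : Set} (g : A → Carrier) xs → sumR g xs ≡ List.foldr _+_ 0# (map g xs)
  sumR≡foldr g [] = refl
  sumR≡foldr g (x ∷ xs) = cong (g x +_) (sumR≡foldr g xs)

  sumR-↭ : ∀ {A : Set} (g : A → Carrier) {xs ys} → xs ↭ ys → sumR g xs ≈ sumR g ys
  sumR-↭ g {xs} {ys} xs↭ys = begin
    sumR g xs                        ≡⟨ sumR≡foldr g xs ⟩
    List.foldr _+_ 0# (map g xs)     ≈⟨ foldr-commMonoid +-isCommutativeMonoid (↭⇒↭ₛ′ isEquivalence (map⁺ g xs↭ys)) ⟩
    List.foldr _+_ 0# (map g ys)     ≡⟨ sumR≡foldr g ys ⟨
    sumR g ys                        ∎

  sumR-map : ∀ {A B : Set} (g : B → Carrier) (h : A → B) xs → sumR g (map h xs) ≡ sumR (g ∘ h) xs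
  sumR-map g h [] = refl
  sumR-map g h (x ∷ xs) = cong (g (h x) +_) (sumR-map g h xs)

  sumR-^ˢ : ∀ {n} (ρ : Permutation′ n) (g : Word n → Carrier) →
    sumR (λ w → g (w ^ˢ ρ)) (allWords n) ≈ sumR g (allWords n)
  sumR-^ˢ {n} ρ g = ≈-trans (reflexive (sym (sumR-map g (_^ˢ ρ) (allWords n)))) (sumR-↭ g (map-^ˢ-allWords ρ))

  sumWhere-cong : ∀ {A : Set} {p : A → Bool} {g h : A → Carrier} →
    (∀ x → T (p x) → g x ≈ h x) → ∀ xs → sumWhere p g xs ≈ sumWhere p h xs
  sumWhere-cong {p = p} {g} {h} g≈h = sumR-cong pointwise
    where
    pointwise : ∀ x → (if p x then g x else 0#) ≈ (if p x then h x else 0#)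
    pointwise x with p x | g≈h x
    ... | true  | g≈hₓ = g≈hₓ tt
    ... | false | _    = ≈-refl

  sumWhere-congᵖ : ∀ {A : Set} {p q : A → Bool} (g : A → Carrier) →
    (∀ x → p x ≡ q x) → ∀ xs → sumWhere p g xs ≈ sumWhere q g xs
  sumWhere-congᵖ g p≡q = sumR-cong (λ x → reflexive (cong (λ b → if b then g x else 0#) (p≡q x)))

  sumWhere-0 : ∀ {A : Set} {p : A → Bool} {g : A → Carrier} →
    (∀ x → T (p x) → g x ≈ 0#) → ∀ xs → sumWhere p g xs ≈ 0#
  sumWhere-0 {p = p} g≈0 xs = ≈-trans (sumWhere-cong g≈0 xs) (sumR-0 pointwise xs)
    where
    pointwise : ∀ x → (if p x then 0# else 0#) ≈ 0#
    pointwise x with p x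
    ... | true  = ≈-refl
    ... | false = ≈-refl

  sumWhere-+ : ∀ {A : Set} (p : A → Bool) (g h : A → Carrier) xs →
    sumWhere p (λ x → g x + h x) xs ≈ sumWhere p g xs + sumWhere p h xs
  sumWhere-+ p g h xs = ≈-trans (sumR-cong pointwise xs) (sumR-+ _ _ xs)
    where
    pointwise : ∀ x → (if p x then g x + h x else 0#) ≈ (if p x then g x else 0#) + (if p x then h x else 0#)
    pointwise x with p x
    ... | true  = ≈-refl
    ... | false = ≈-sym (+-identityˡ 0#)

  sumWhere-const : ∀ {A : Set} (p : A → Bool) c xs → sumWhere p (λ _ → c) xs ≈ natMul (count p xs) c
  sumWhere-const p c [] = ≈-refl
  sumWhere-const p c (x ∷ xs) with p x
  ... | true  = +-congˡ (sumWhere-const p c xs)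
  ... | false = ≈-trans (+-identityˡ _) (sumWhere-const p c xs)

  sumWhere-natMul : ∀ {A : Set} (p : A → Bool) m (g : A → Carrier) xs →
    sumWhere p (λ x → natMul m (g x)) xs ≈ natMul m (sumWhere p g xs)
  sumWhere-natMul p zero g xs = sumWhere-0 (λ _ _ → ≈-refl) xs
  sumWhere-natMul p (suc m) g xs =
    ≈-trans (sumWhere-+ p g (λ x → natMul m (g x)) xs) (+-congˡ (sumWhere-natMul p m g xs))

  sumWhere-comm : ∀ {A B : Set} (p : A → Bool) (q : B → Bool) (rel : A → B → Bool) (g : A → B → Carrier) xs ys →
      sumWhere p (λ x → sumWhere (λ y → q y ∧ rel x y) (g x) ys) xs
    ≈ sumWhere q (λ y → sumWhere (λ x → p x ∧ rel x y) (λ x → g x y) xs) ys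
  sumWhere-comm p q rel g xs ys = begin
    sumR (λ x → if p x then sumR (λ y → if q y ∧ rel x y then g x y else 0#) ys else 0#) xs
      ≈⟨ sumR-cong (λ x → if-sumR (p x) _ ys) xs ⟩
    sumR (λ x → sumR (λ y → if p x then (if q y ∧ rel x y then g x y else 0#) else 0#) ys) xs
      ≈⟨ sumR-comm _ xs ys ⟩
    sumR (λ y → sumR (λ x → if p x then (if q y ∧ rel x y then g x y else 0#) else 0#) xs) ys
      ≈⟨ sumR-cong (λ y → sumR-cong (λ x → reflexive (if-if-∧ (p x) (q y) (rel x y) (g x y))) xs) ys ⟩
    sumR (λ y → sumR (λ x → if q y then (if p x ∧ rel x y then g x y else 0#) else 0#) xs) ys
      ≈⟨ sumR-cong (λ y → ≈-sym (if-sumR (q y) _ xs)) ys ⟩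
    sumR (λ y → if q y then sumR (λ x → if p x ∧ rel x y then g x y else 0#) xs else 0#) ys ∎
    where
    if-sumR : ∀ {C : Set} b (h : C → Carrier) zs → (if b then sumR h zs else 0#) ≈ sumR (λ z → if b then h z else 0#) zs
    if-sumR true  h zs = ≈-refl
    if-sumR false h zs = ≈-sym (sumR-0 (λ _ → ≈-refl) zs)
    if-if-∧ : ∀ a b c (z : Carrier) →
      (if a then (if b ∧ c then z else 0#) else 0#) ≡ (if b then (if a ∧ c then z else 0#) else 0#)
    if-if-∧ true  true  c z = refl
    if-if-∧ true  false c z = refl
    if-if-∧ false true  c z = refl
    if-if-∧ false false c z = refl

  -- Harmonic functions and their weight enumerators

  natMul-torsionFree : NoAdditiveTorsion → ∀ {m x} → ¬ m ≡ 0 → natMul m x ≈ 0# → x ≈ 0#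
  natMul-torsionFree noTorsion m≢0 mx≈0 with noTorsion _ _ mx≈0
  ... | inj₁ m≡0 = ⊥-elim (m≢0 m≡0)
  ... | inj₂ x≈0 = x≈0

  harmonic-sum≈0 : NoAdditiveTorsion → ∀ {n} k (f : Subset n → Carrier) → IsHarmonic (suc k) f →
    sumWhere (λ z → ∣ z ∣ ≡ᵇ suc k) f (allWords n) ≈ 0#
  harmonic-sum≈0 noTorsion {n} k f harmonic = natMul-torsionFree noTorsion {suc k} (λ ()) (begin
    natMul (suc k) (sumWhere (λ z → ∣ z ∣ ≡ᵇ suc k) f ws)
      ≈⟨ sumWhere-natMul _ (suc k) f ws ⟨
    sumWhere (λ z → ∣ z ∣ ≡ᵇ suc k) (λ z → natMul (suc k) (f z)) ws
      ≈⟨ sumWhere-cong (λ z ∣z∣≡ᵇ1+k → reflexive (cong (λ m → natMul m (f z)) (sym (count-facets z (≡ᵇ⇒≡ _ _ ∣z∣≡ᵇ1+k))))) ws ⟩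
    sumWhere (λ z → ∣ z ∣ ≡ᵇ suc k) (λ z → natMul (count (λ y → (∣ y ∣ ≡ᵇ k) ∧ (y ⊆ᵇ z)) ws) (f z)) ws
      ≈⟨ sumWhere-cong (λ z _ → sumWhere-const _ (f z) ws) ws ⟨
    sumWhere (λ z → ∣ z ∣ ≡ᵇ suc k) (λ z → sumWhere (λ y → (∣ y ∣ ≡ᵇ k) ∧ (y ⊆ᵇ z)) (λ _ → f z) ws) ws
      ≈⟨ sumWhere-comm (λ y → ∣ y ∣ ≡ᵇ k) (λ z → ∣ z ∣ ≡ᵇ suc k) _⊆ᵇ_ (λ _ z → f z) ws ws ⟨
    sumWhere (λ y → ∣ y ∣ ≡ᵇ k) (λ y → sumWhere (λ z → (∣ z ∣ ≡ᵇ suc k) ∧ (y ⊆ᵇ z)) f ws) ws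
      ≈⟨ sumWhere-0 (λ y ∣y∣≡ᵇk → harmonic y (≡ᵇ⇒≡ _ _ ∣y∣≡ᵇk)) ws ⟩
    0# ∎)
    where
    ws : List (Word n)
    ws = allWords n
    count-facets : ∀ z → ∣ z ∣ ≡ suc k → count (λ y → (∣ y ∣ ≡ᵇ k) ∧ (y ⊆ᵇ z)) ws ≡ suc k
    count-facets z ∣z∣≡1+k = trans (count-subsets n z k) (trans (cong (_choose k) ∣z∣≡1+k) ([1+k]Ck≡1+k k))

  tilde-^ˢ : ∀ {n} k (f : Subset n → Carrier) (ρ : Permutation′ n) u →
    tilde k f (u ^ˢ ρ) ≈ tilde k (λ z → f (z ^ˢ ρ)) u
  tilde-^ˢ {n} k f ρ u = ≈-trans (≈-sym (sumR-^ˢ ρ _))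
    (sumWhere-congᵖ (λ z → f (z ^ˢ ρ)) (λ z → cong₂ (λ m b → (m ≡ᵇ k) ∧ b) (∣^ˢ∣ ρ z) (^ˢ-⊆ᵇ ρ z u)) (allWords n))

  tilde-0 : ∀ {n} k (f : Subset n → Carrier) → (∀ z → ∣ z ∣ ≡ k → f z ≈ 0#) → ∀ u → tilde k f u ≈ 0#
  tilde-0 {n} k f f≈0 u = sumWhere-0 (λ z z∈ → f≈0 z (≡ᵇ⇒≡ _ _ (proj₁ (T-∧ .Equivalence.to z∈)))) (allWords n)

  harmWE-cong : ∀ {n} {D E : WordSet n} → CodeEq D E → ∀ k f i → harmWE D k f i ≈ harmWE E k f i
  harmWE-cong {n} D≡E k f i = sumWhere-congᵖ (tilde k f) (λ w → cong (_∧ _) (D≡E w)) (allWords n)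

  harmWE-^ᶜ : ∀ {n} (C : WordSet n) (ρ : Permutation′ n) k f i →
    harmWE (C ^ᶜ ρ) k f i ≈ harmWE C k (λ z → f (z ^ˢ flip ρ)) i
  harmWE-^ᶜ {n} C ρ k f i = begin
    sumWhere (λ w → C (w ^ˢ ρ) ∧ (∣ w ∣ ≡ᵇ i)) (tilde k f) ws
      ≈⟨ sumR-^ˢ (flip ρ) _ ⟨
    sumWhere (λ v → C ((v ^ˢ flip ρ) ^ˢ ρ) ∧ (∣ v ^ˢ flip ρ ∣ ≡ᵇ i)) (λ v → tilde k f (v ^ˢ flip ρ)) ws
      ≈⟨ sumWhere-congᵖ _ (λ v → cong₂ (λ w m → C w ∧ (m ≡ᵇ i)) (^ˢ-inverseʳ ρ v) (∣^ˢ∣ (flip ρ) v)) ws ⟩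
    sumWhere (λ v → C v ∧ (∣ v ∣ ≡ᵇ i)) (λ v → tilde k f (v ^ˢ flip ρ)) ws
      ≈⟨ sumWhere-cong (λ v _ → tilde-^ˢ k f (flip ρ) v) ws ⟩
    sumWhere (λ v → C v ∧ (∣ v ∣ ≡ᵇ i)) (tilde k (λ z → f (z ^ˢ flip ρ))) ws ∎
    where
    ws : List (Word n)
    ws = allWords n

  harmWE-+ : ∀ {n} (C : WordSet n) k (f g : Subset n → Carrier) i →
    harmWE C k (λ z → f z + g z) i ≈ harmWE C k f i + harmWE C k g i
  harmWE-+ {n} C k f g i = ≈-trans
    (sumWhere-cong (λ u _ → sumWhere-+ (λ z → (∣ z ∣ ≡ᵇ k) ∧ (z ⊆ᵇ u)) f g (allWords n)) (allWords n))
    (sumWhere-+ _ (tilde k f) (tilde k g) (allWords n))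

  harmWE-0 : ∀ {n} (C : WordSet n) k (f : Subset n → Carrier) → (∀ z → ∣ z ∣ ≡ k → f z ≈ 0#) → ∀ i → harmWE C k f i ≈ 0#
  harmWE-0 {n} C k f f≈0 i = sumWhere-0 (λ u _ → tilde-0 k f f≈0 u) (allWords n)

  harmWE-+-dual≈0 : ∀ {n} (C : WordSet n) (ρ : Permutation′ n) → CodeEq (dual C) (C ^ᶜ ρ) → ∀ k (f : Subset n → Carrier) →
    (∀ S → ∣ S ∣ ≡ k → f S + f (S ^ˢ ρ) ≈ 0#) → ∀ i → harmWE C k f i + harmWE (dual C) k f i ≈ 0#
  harmWE-+-dual≈0 C ρ dual≡Cρ k f antisymmetric i = begin
    harmWE C k f i + harmWE (dual C) k f i                    ≈⟨ +-congˡ (harmWE-cong {D = dual C} {C ^ᶜ ρ} dual≡Cρ k f i) ⟩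
    harmWE C k f i + harmWE (C ^ᶜ ρ) k f i                    ≈⟨ +-congˡ (harmWE-^ᶜ C ρ k f i) ⟩
    harmWE C k f i + harmWE C k (λ z → f (z ^ˢ flip ρ)) i     ≈⟨ harmWE-+ C k f _ i ⟨
    harmWE C k (λ z → f z + f (z ^ˢ flip ρ)) i                ≈⟨ harmWE-0 C k _ antisymmetric′ i ⟩
    0#                                                        ∎
    where
    antisymmetric′ : ∀ z → ∣ z ∣ ≡ k → f z + f (z ^ˢ flip ρ) ≈ 0#
    antisymmetric′ z ∣z∣ = ≈-trans (+-comm _ _) (≈-trans
      (+-congˡ (reflexive (cong f (sym (^ˢ-inverseʳ ρ z)))))
      (antisymmetric (z ^ˢ flip ρ) (trans (∣^ˢ∣ (flip ρ) z) ∣z∣)))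

  invariant-inOrbit : ∀ {n} {C : WordSet n} {k f U S} → IsAutInvariant C k f → ∣ U ∣ ≡ k → InOrbit C U S → f S ≈ f U
  invariant-inOrbit {f = f} {U} invariant ∣U∣ (α , autα , refl) =
    ≈-sym (≈-trans (reflexive (cong f (sym (^ˢ-inverseˡ α U)))) (invariant α autα (U ^ˢ α) (trans (∣^ˢ∣ α U) ∣U∣)))

  invariant-+-^ˢ : ∀ {n} {C : WordSet n} {σ t T₁ T₂ f} → IsAutInvariant C t f → ∣ T₁ ∣ ≡ t → ∣ T₂ ∣ ≡ t →
    SwapsOrbits C σ t T₁ T₂ → ∀ S → ∣ S ∣ ≡ t → f S + f (S ^ˢ σ) ≈ f T₁ + f T₂
  invariant-+-^ˢ {T₁ = T₁} {T₂} invariant ∣T₁∣ ∣T₂∣ swaps S ∣S∣ with swapped swaps S ∣S∣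
  ... | inj₁ (S∈GT₁ , Sσ∈GT₂) =
    +-cong (invariant-inOrbit {U = T₁} invariant ∣T₁∣ S∈GT₁) (invariant-inOrbit {U = T₂} invariant ∣T₂∣ Sσ∈GT₂)
  ... | inj₂ (S∈GT₂ , Sσ∈GT₁) = ≈-trans
    (+-cong (invariant-inOrbit {U = T₂} invariant ∣T₂∣ S∈GT₂) (invariant-inOrbit {U = T₁} invariant ∣T₁∣ Sσ∈GT₁)) (+-comm _ _)

  invariant-harmonic-antisymmetric : NoAdditiveTorsion → ∀ {n} {C : WordSet n} {σ k T₁ T₂ f} →
    IsHarmonic (suc k) f → IsAutInvariant C (suc k) f → ∣ T₁ ∣ ≡ suc k → ∣ T₂ ∣ ≡ suc k →
    SwapsOrbits C σ (suc k) T₁ T₂ → ∀ S → ∣ S ∣ ≡ suc k → f S + f (S ^ˢ σ) ≈ 0#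
  invariant-harmonic-antisymmetric noTorsion {n} {_} {σ} {k} {T₁} {T₂} {f} harmonic invariant ∣T₁∣ ∣T₂∣ swaps S ∣S∣ =
    ≈-trans (invariant-+-^ˢ invariant ∣T₁∣ ∣T₂∣ swaps S ∣S∣) T₁+T₂≈0
    where
    ws : List (Word n)
    ws = allWords n
    isFacet : Subset n → Bool
    isFacet z = ∣ z ∣ ≡ᵇ suc k
    F : Carrier
    F = sumWhere isFacet f ws
    T₁+T₂≈0 : f T₁ + f T₂ ≈ 0#
    T₁+T₂≈0 = natMul-torsionFree noTorsion (∈⇒count≢0 isFacet (allWords-complete n T₁) (≡⇒≡ᵇ _ _ ∣T₁∣)) (begin
      natMul (count isFacet ws) (f T₁ + f T₂)
        ≈⟨ sumWhere-const isFacet _ ws ⟨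
      sumWhere isFacet (λ _ → f T₁ + f T₂) ws
        ≈⟨ sumWhere-cong (λ z ∣z∣ → invariant-+-^ˢ invariant ∣T₁∣ ∣T₂∣ swaps z (≡ᵇ⇒≡ _ _ ∣z∣)) ws ⟨
      sumWhere isFacet (λ z → f z + f (z ^ˢ σ)) ws
        ≈⟨ sumWhere-+ isFacet f _ ws ⟩
      F + sumWhere isFacet (λ z → f (z ^ˢ σ)) ws
        ≈⟨ +-congˡ (≈-trans (sumWhere-congᵖ _ (λ z → cong (_≡ᵇ suc k) (sym (∣^ˢ∣ σ z))) ws) (sumR-^ˢ σ _)) ⟩
      F + F
        ≈⟨ +-cong (harmonic-sum≈0 noTorsion k f harmonic) (harmonic-sum≈0 noTorsion k f harmonic) ⟩
      0# + 0#
        ≈⟨ +-identityˡ 0# ⟩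
      0# ∎)

open import Data.Nat using (_+_)

theorem1p1 : ∀ {r ℓ : Level} (R : CommutativeRing r ℓ) → Harmonic.NoAdditiveTorsion R →
    (n : ℕ) (C : WordSet n) → IsLinearCode C →
    (σ : Permutation′ n) → CodeEq (dual C) (C ^ᶜ σ) →
    (t : ℕ) → 1 ≤ t →
    (T₁ T₂ : Subset n) → ∣ T₁ ∣ ≡ t → ∣ T₂ ∣ ≡ t →
    (∀ S → ∣ S ∣ ≡ t → InOrbit C T₁ S ⊎ InOrbit C T₂ S) →
    ¬ InOrbit C T₁ T₂ →
    (∀ S → InOrbit C T₁ S → InOrbit C T₂ (S ^ˢ σ)) →
    (∀ S → InOrbit C T₂ S → ∃ λ S′ → InOrbit C T₁ S′ × (S ≡ S′ ^ˢ σ)) →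
    (∀ T T′ → ∣ T ∣ ≡ t → ∣ T′ ∣ ≡ t → ∀ a b c d →
      jacobi C T a b c d + jacobi (dual C) T a b c d
        ≡ jacobi C T′ a b c d + jacobi (dual C) T′ a b c d)
    × (∀ f → Harmonic.IsHarmonic R t f → Harmonic.IsAutInvariant R C t f →
      ∀ i → CommutativeRing._≈_ R
        (CommutativeRing._+_ R (Harmonic.harmWE R C t f i) (Harmonic.harmWE R (dual C) t f i))
        (CommutativeRing.0# R))
theorem1p1 R noTorsion n C _ σ dual≡Cσ t (s≤s {n = k} z≤n) T₁ T₂ ∣T₁∣ ∣T₂∣ cover distinct σ[GT₁]⊆GT₂ GT₂⊆σ[GT₁] =
  (λ T T′ ∣T∣ ∣T′∣ a b c d →
    trans (jacobi-+-dual dual≡Cσ swaps T ∣T∣ a b c d)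
          (sym (jacobi-+-dual dual≡Cσ swaps T′ ∣T′∣ a b c d))) ,
  (λ f harmonic invariant i →
    harmWE-+-dual≈0 R C σ dual≡Cσ t f (invariant-harmonic-antisymmetric R noTorsion harmonic invariant ∣T₁∣ ∣T₂∣ swaps) i)
  where
  swaps : SwapsOrbits C σ t T₁ T₂
  swaps = swapsOrbits cover distinct σ[GT₁]⊆GT₂ GT₂⊆σ[GT₁]
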